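{- Let $G$, $H$, $F$ be as in the context (in particular $G$ has no $H$-factor and $F$ is the fixed spanning subgraph described there). Then $F$ has no augmenting changeable trail, i.e. there is no changeable trail $P$ (with respect to $F$) such that $def_H[F\triangle P]<def_H[F]$.
   Context: $G$ is a finite simple graph and $H:V(G)\to 2^{\mathbb{N}}$ assigns to each vertex $x$ a nonempty finite set $H(x)$ of nonnegative integers. Write $mH(x)=\min H(x)$, $MH(x)=\max H(x)$. $H$ satisfies property $(*)$: for every vertex $x$ and every integer $i$ with $mH(x)\le i\le MH(x)$, if $i\notin H(x)$ then $i+1\in H(x)$. For a spanning subgraph $F$ of $G$ and $x\in V(G)$, $def(F;x)=dist(d_F(x),H(x))=\min_{h\in H(x)}|d_F(x)-h|$; for $S\subseteq V(G)$, $def(F;S)=\sum_{x\in S}def(F;x)$; $def_H[F]=def(F;V(G))$; $def_H(G)=\min\{def_H[F]: F \text{ a spanning subgraph of } G\}$. An $H$-factor is a spanning subgraph $F$ with $d_F(x)\in H(x)$ for all $x$; $F$ is $H$-optimal if $def_H[F]=def_H(G)$. Standing assumptions: $G$ has no $H$-factor, and $F$ is a fixed spanning subgraph of $G$ chosen as follows: among all spanning subgraphs with $d_F(v)\le MH(v)$ for all $v$, $F$ minimizes $def_H[F]$, and subject to this $E(F)$ is (inclusion-)minimal. Let $B_0=\{x\in V(G): d_F(x)\notin H(x)\}$. For a trail $P$ (a walk with no repeated edge), $F\triangle P$ is the spanning subgraph with edge set $E(F)\triangle E(P)$. A trail $P=v_0v_1\dots v_k$ is a changeable trail if: (a) $v_0\in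 B_0$ and $v_0v_1\notin E(F)$; (b) $def(F;x)=def(F\triangle P;x)=0$ for every vertex $x$ of $P$ other than $v_0$ and $v_k$; (c) if $v_0=v_i\ne v_k$ for some $i$, then $def(F;v_0)>def(F\triangle P;v_0)$; (d) every initial subtrail $v_0v_1\dots v_l$, $l\le k$, also satisfies (a)–(c). A changeable trail is odd if its last edge is not in $F$, and even otherwise; trails of length zero (a single vertex of $B_0$) are even changeable trails. A changeable trail $P$ is augmenting if $def_H[F\triangle P]<def_H[F]$. -}

module Defs where

open import Data.Nat using (ℕ; zero; suc; _≤_; _<_; _⊓_; _⊔_; ∣_-_∣)
open import Data.Fin using (Fin; _≟_)
open import Data.Bool using (Bool; true; false; if_then_else_; _∧_; _∨_; _xor_; T)
open import Data.List using (List; []; _∷_; map; allFin; take)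
open import Data.Nat.ListAction using (sum)
open import Data.Bool.ListAction using (any)
open import Data.List.NonEmpty using (List⁺; toList; foldr₁) renaming (map to map⁺)
open import Data.List.Membership.Propositional using (_∈_)
open import Data.List.Relation.Unary.All using (All)
open import Data.List.Relation.Unary.AllPairs using (AllPairs)
open import Data.Product using (Σ; _×_; _,_; proj₁; proj₂)
open import Data.Sum using (_⊎_)
open import Data.Unit using (⊤)
open import Relation.Nullary using (¬_)
open import Relation.Nullary.Decidable using (⌊_⌋)
open import Relation.Binary.PropositionalEquality using (_≡_; _≢_)

record SimpleGraph (n : ℕ) : Set where
  field
    adj    : Fin n → Fin n → Bool
    sym    : ∀ x y → adj x y ≡ adj y x
    irrefl : ∀ x → adj x x ≡ false
open SimpleGraph public

EdgeSet : ℕ → Set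
EdgeSet n = Fin n → Fin n → Bool

_⊆ₑ_ : ∀ {n} → EdgeSet n → EdgeSet n → Set
A ⊆ₑ B = ∀ x y → T (A x y) → T (B x y)

Spanning : ∀ {n} → SimpleGraph n → EdgeSet n → Set
Spanning G F = (∀ x y → F x y ≡ F y x) × (F ⊆ₑ adj G)

deg : ∀ {n} → EdgeSet n → Fin n → ℕ
deg {n} F x = sum (map (λ y → if F x y then 1 else 0) (allFin n))

-- H assigns a nonempty finite set (a nonempty list) of naturals to each vertex.
Assign : ℕ → Set
Assign n = Fin n → List⁺ ℕ

mH MH : ∀ {n} → Assign n → Fin n → ℕ
mH H x = foldr₁ _⊓_ (H x)
MH H x = foldr₁ _⊔_ (H x)

Star : ∀ {n} → Assign n → Set
Star H = ∀ x (i : ℕ) → mH H x ≤ i → i ≤ MH H x →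
         ¬ (i ∈ toList (H x)) → suc i ∈ toList (H x)

dist : ℕ → List⁺ ℕ → ℕ
dist d S = foldr₁ _⊓_ (map⁺ (λ h → ∣ d - h ∣) S)

defv : ∀ {n} → Assign n → EdgeSet n → Fin n → ℕ
defv H F x = dist (deg F x) (H x)

defTotal : ∀ {n} → Assign n → EdgeSet n → ℕ
defTotal {n} H F = sum (map (defv H F) (allFin n))

IsHFactor : ∀ {n} → SimpleGraph n → Assign n → EdgeSet n → Set
IsHFactor G H F = Spanning G F × (∀ x → deg F x ∈ toList (H x))

Bounded : ∀ {n} → Assign n → EdgeSet n → Set
Bounded H F = ∀ x → deg F x ≤ MH H x

InB0 : ∀ {n} → Assign n → EdgeSet n → Fin n → Set
InB0 H F x = ¬ (deg F x ∈ toList (H x))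

-- Walks / trails: a walk v0 v1 … vk is given by its start v0 and the list
-- [v1, …, vk].

Walk : ℕ → Set
Walk n = Fin n × List (Fin n)

start : ∀ {n} → Walk n → Fin n
start = proj₁

lastV : ∀ {n} → Fin n → List (Fin n) → Fin n
lastV v []       = v
lastV v (w ∷ ws) = lastV w ws

endV : ∀ {n} → Walk n → Fin n
endV (v , vs) = lastV v vs

vertices : ∀ {n} → Walk n → List (Fin n)
vertices (v , vs) = v ∷ vs

edgesFrom : ∀ {n} → Fin n → List (Fin n) → List (Fin n × Fin n)
edgesFrom v []       = []
edgesFrom v (w ∷ ws) = (v , w) ∷ edgesFrom w ws

edges : ∀ {n} → Walk n → List (Fin n × Fin n)
edges (v , vs) = edgesFrom v vs

SameEdge : ∀ {n} → Fin n × Fin n → Fin n × Fin n → Set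
SameEdge (a , b) (c , d) = (a ≡ c × b ≡ d) ⊎ (a ≡ d × b ≡ c)

IsTrail : ∀ {n} → SimpleGraph n → Walk n → Set
IsTrail G P = All (λ e → T (adj G (proj₁ e) (proj₂ e))) (edges P)
            × AllPairs (λ e e′ → ¬ SameEdge e e′) (edges P)

inP : ∀ {n} → Walk n → Fin n → Fin n → Bool
inP P x y = any (λ e → (⌊ proj₁ e ≟ x ⌋ ∧ ⌊ proj₂ e ≟ y ⌋)
                     ∨ (⌊ proj₁ e ≟ y ⌋ ∧ ⌊ proj₂ e ≟ x ⌋)) (edges P)

_△_ : ∀ {n} → EdgeSet n → Walk n → EdgeSet n
(F △ P) x y = F x y xor inP P x y

prefix : ∀ {n} → ℕ → Walk n → Walk n
prefix l (v , vs) = v , take l vs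

FirstEdgeNotInF : ∀ {n} → EdgeSet n → Walk n → Set
FirstEdgeNotInF F (v , [])     = ⊤
FirstEdgeNotInF F (v , w ∷ ws) = F v w ≡ false

CondABC : ∀ {n} → Assign n → EdgeSet n → Walk n → Set
CondABC H F P =
    (InB0 H F (start P) × FirstEdgeNotInF F P)
  × (∀ x → x ∈ vertices P → x ≢ start P → x ≢ endV P →
       defv H F x ≡ 0 × defv H (F △ P) x ≡ 0)
  × (start P ∈ proj₂ P → start P ≢ endV P →
       defv H (F △ P) (start P) < defv H F (start P))

Changeable : ∀ {n} → SimpleGraph n → Assign n → EdgeSet n → Walk n → Set
Changeable G H F P = IsTrail G P × (∀ l → CondABC H F (prefix l P))

-- An augmenting trail P makes F △ P a spanning subgraph of G with smaller deficiency than F.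
-- Now F △ P may exceed MH somewhere, but deleting an edge xy at a vertex x with d(x) > MH(x)
-- lowers def(x) by one (all of H(x) lies below the new degree) and raises def(y) by at most one.
-- Repeating this ends in a spanning subgraph with all degrees ≤ MH and deficiency below def_H[F],
-- contradicting the choice of F.
module Submission where

open import Defs hiding (sym)
open import Data.Nat using (ℕ; zero; suc; _+_; _∸_; _≤_; _<_; _≤?_; _⊓_; _⊔_; ∣_-_∣; z≤n; s≤s⁻¹)
open import Data.Nat.Properties hiding (_≟_)
open import Algebra.Properties.CommutativeMonoid.Sum +-0-commutativeMonoid
  using (sum-syntax; sum-cong-≗; ∑-distrib-+; sum-replicate-zero)
open import Data.Fin using (Fin; zero; suc; _≟_)
open import Data.Fin.Properties using (all?; ¬∀⟶∃¬)
open import Data.Bool using (Bool; true; false; if_then_else_; _∧_; _∨_; _xor_; T)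
open import Data.Bool.Properties using (∧-comm; ∨-comm; xor-identityʳ; T-∧; T-∨)
open import Data.Bool.ListAction using (any)
open import Data.List using (List; []; _∷_; map; allFin; tabulate)
open import Data.List.Properties using (map-tabulate; map-cong)
open import Data.Nat.ListAction using (sum)
open import Data.List.NonEmpty using (List⁺; toList; foldr₁) renaming (map to map⁺; _∷_ to _∷⁺_)
open import Data.List.Membership.Propositional using (_∈_)
open import Data.List.Relation.Unary.Any using (here; there)
open import Data.List.Relation.Unary.Any.Properties using (any⁻)
open import Data.List.Relation.Unary.All using (All; []; _∷_; lookupAny)
open import Data.Sum as Sum using (inj₁; inj₂)
open import Data.Product as Product using (Σ; ∃; _×_; _,_; proj₁; proj₂)
open import Function using (id; _∘_; _$_)
open import Function.Bundles using (Equivalence)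
open import Relation.Nullary using (¬_; Dec; yes; no; contradiction)
open import Relation.Nullary.Decidable using (⌊_⌋; toWitness)
open import Relation.Binary.PropositionalEquality

sum-tabulate : ∀ {n} (f : Fin n → ℕ) → sum (tabulate f) ≡ ∑[ i < n ] f i
sum-tabulate {zero}  f = refl
sum-tabulate {suc n} f = cong (f zero +_) (sum-tabulate (f ∘ suc))

sum-map-allFin : ∀ {n} (f : Fin n → ℕ) → sum (map f (allFin n)) ≡ ∑[ i < n ] f i
sum-map-allFin f = trans (cong sum (map-tabulate id f)) (sum-tabulate f)

∑-mono-≤ : ∀ {n} {f g : Fin n → ℕ} → (∀ i → f i ≤ g i) → ∑[ i < n ] f i ≤ ∑[ i < n ] g i
∑-mono-≤ {zero}  f≤g = z≤n
∑-mono-≤ {suc n} f≤g = +-mono-≤ (f≤g zero) (∑-mono-≤ (f≤g ∘ suc))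

bit : Bool → ℕ
bit b = if b then 1 else 0

∑-bit-pos⇒true : ∀ {n} (b : Fin n → Bool) → 0 < ∑[ i < n ] bit (b i) → ∃ λ i → b i ≡ true
∑-bit-pos⇒true {suc n} b pos with b zero in eq
... | true  = zero , eq
... | false = Product.map suc id (∑-bit-pos⇒true (b ∘ suc) pos)

indicator : ∀ {n} → Fin n → Fin n → ℕ
indicator x z = bit ⌊ x ≟ z ⌋

indicator-self : ∀ {n} (x : Fin n) → indicator x x ≡ 1
indicator-self x with x ≟ x
... | yes _   = refl
... | no x≢x  = contradiction refl x≢x

indicator-≢ : ∀ {n} {x z : Fin n} → x ≢ z → indicator x z ≡ 0
indicator-≢ {x = x} {z} x≢z with x ≟ z
... | yes x≡z = contradiction x≡z x≢z
... | no _    = refl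

indicator-suc : ∀ {n} (x z : Fin n) → indicator (suc x) (suc z) ≡ indicator x z
indicator-suc x z with x ≟ z
... | yes _ = refl
... | no _  = refl

∑-indicator : ∀ {n} (x : Fin n) → ∑[ z < n ] indicator x z ≡ 1
∑-indicator {suc n} zero    = cong suc (sum-replicate-zero n)
∑-indicator {suc n} (suc x) = trans (sum-cong-≗ (indicator-suc x)) (∑-indicator x)

∑-indicator-+ : ∀ {n} (x : Fin n) (f : Fin n → ℕ) →
                ∑[ z < n ] (indicator x z + f z) ≡ suc (∑[ z < n ] f z)
∑-indicator-+ {n} x f = trans (∑-distrib-+ (indicator x) f) (cong (_+ ∑[ z < n ] f z) (∑-indicator x))

⊓-map⁺-mono : ∀ (S : List⁺ ℕ) {f g : ℕ → ℕ} {k l : ℕ} →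
              (∀ h → h ∈ toList S → k + f h ≤ l + g h) →
              k + foldr₁ _⊓_ (map⁺ f S) ≤ l + foldr₁ _⊓_ (map⁺ g S)
⊓-map⁺-mono (h ∷⁺ hs) {f} {g} {k} {l} = go h hs
  where
  open ≤-Reasoning
  min : (ℕ → ℕ) → ℕ → List ℕ → ℕ
  min φ h hs = foldr₁ _⊓_ (map⁺ φ (h ∷⁺ hs))

  go : ∀ h hs → (∀ e → e ∈ toList (h ∷⁺ hs) → k + f e ≤ l + g e) →
       k + min f h hs ≤ l + min g h hs
  go h []        f≤g = f≤g h (here refl)
  go h (h′ ∷ hs) f≤g = begin
    k + (f h ⊓ min f h′ hs)        ≡⟨ +-distribˡ-⊓ k (f h) _ ⟩
    (k + f h) ⊓ (k + min f h′ hs)  ≤⟨ ⊓-mono-≤ (f≤g h (here refl)) (go h′ hs (λ e → f≤g e ∘ there)) ⟩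
    (l + g h) ⊓ (l + min g h′ hs)  ≡⟨ +-distribˡ-⊓ l (g h) _ ⟨
    l + (g h ⊓ min g h′ hs)        ∎

≤-foldr₁-⊔ : ∀ (S : List⁺ ℕ) {h} → h ∈ toList S → h ≤ foldr₁ _⊔_ S
≤-foldr₁-⊔ (h ∷⁺ [])      (here refl) = ≤-refl
≤-foldr₁-⊔ (h ∷⁺ h′ ∷ hs) (here refl) = m≤m⊔n h _
≤-foldr₁-⊔ (h ∷⁺ h′ ∷ hs) (there h∈) = ≤-trans (≤-foldr₁-⊔ (h′ ∷⁺ hs) h∈) (m≤n⊔m h _)

∣n-1+n∣≡1 : ∀ n → ∣ n - suc n ∣ ≡ 1
∣n-1+n∣≡1 zero    = refl
∣n-1+n∣≡1 (suc n) = ∣n-1+n∣≡1 n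

dist-≤-1+dist-suc : ∀ d S → dist d S ≤ suc (dist (suc d) S)
dist-≤-1+dist-suc d S = ⊓-map⁺-mono S {k = 0} λ h _ → begin
  ∣ d - h ∣                        ≤⟨ ∣-∣-triangle d (suc d) h ⟩
  ∣ d - suc d ∣ + ∣ suc d - h ∣    ≡⟨ cong (_+ ∣ suc d - h ∣) (∣n-1+n∣≡1 d) ⟩
  suc ∣ suc d - h ∣                ∎
  where open ≤-Reasoning

dist-<-dist-suc : ∀ d S → (∀ h → h ∈ toList S → h ≤ d) → dist d S < dist (suc d) S
dist-<-dist-suc d S below = ⊓-map⁺-mono S {l = 0} λ h h∈ → ≤-reflexive $ begin
  suc ∣ d - h ∣   ≡⟨ cong suc (m≤n⇒∣n-m∣≡n∸m (below h h∈)) ⟩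
  suc (d ∸ h)     ≡⟨ +-∸-assoc 1 (below h h∈) ⟨
  suc d ∸ h       ≡⟨ m≤n⇒∣n-m∣≡n∸m (m≤n⇒m≤1+n (below h h∈)) ⟨
  ∣ suc d - h ∣   ∎
  where open ≡-Reasoning

deg≡∑ : ∀ {n} (F : EdgeSet n) x → deg F x ≡ ∑[ w < n ] bit (F x w)
deg≡∑ F x = sum-map-allFin (bit ∘ F x)

deg-cong : ∀ {n} (F F′ : EdgeSet n) x → (∀ w → F x w ≡ F′ x w) → deg F x ≡ deg F′ x
deg-cong {n} _ _ x Fx≗F′x = cong sum (map-cong (cong bit ∘ Fx≗F′x) (allFin n))

defTotal≡∑ : ∀ {n} (H : Assign n) (F : EdgeSet n) → defTotal H F ≡ ∑[ x < n ] defv H F x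
defTotal≡∑ H F = sum-map-allFin (defv H F)

totalDegree : ∀ {n} → EdgeSet n → ℕ
totalDegree {n} F = ∑[ x < n ] deg F x

joins : ∀ {n} → Fin n → Fin n → Fin n × Fin n → Bool
joins x y e = (⌊ proj₁ e ≟ x ⌋ ∧ ⌊ proj₂ e ≟ y ⌋) ∨ (⌊ proj₁ e ≟ y ⌋ ∧ ⌊ proj₂ e ≟ x ⌋)

joins-sym : ∀ {n} (x y : Fin n) e → joins x y e ≡ joins y x e
joins-sym x y e = ∨-comm (⌊ proj₁ e ≟ x ⌋ ∧ ⌊ proj₂ e ≟ y ⌋) _

joins⇒SameEdge : ∀ {n} {x y : Fin n} e → T (joins x y e) → SameEdge e (x , y)
joins⇒SameEdge e = Sum.map witnesses witnesses ∘ Equivalence.to T-∨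
  where
  witnesses : ∀ {n} {a b c d : Fin n} → T (⌊ a ≟ c ⌋ ∧ ⌊ b ≟ d ⌋) → a ≡ c × b ≡ d
  witnesses {a = a} {b} {c} {d} =
    Product.map (toWitness {a? = a ≟ c}) (toWitness {a? = b ≟ d}) ∘ Equivalence.to T-∧

inP-sym : ∀ {n} (P : Walk n) x y → inP P x y ≡ inP P y x
inP-sym P x y = go (edges P)
  where
  go : ∀ es → any (joins x y) es ≡ any (joins y x) es
  go []       = refl
  go (e ∷ es) = cong₂ _∨_ (joins-sym x y e) (go es)

EdgesIn : ∀ {n} → SimpleGraph n → Walk n → Set
EdgesIn G P = All (λ e → T (adj G (proj₁ e) (proj₂ e))) (edges P)

SameEdge⇒adj : ∀ {n} (G : SimpleGraph n) {e : Fin n × Fin n} {x y} →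
               SameEdge e (x , y) → T (adj G (proj₁ e) (proj₂ e)) → T (adj G x y)
SameEdge⇒adj G     (inj₁ (refl , refl)) = id
SameEdge⇒adj G {e} (inj₂ (refl , refl)) = subst T (SimpleGraph.sym G (proj₁ e) (proj₂ e))

inP⇒adj : ∀ {n} (G : SimpleGraph n) (P : Walk n) {x y} → EdgesIn G P → T (inP P x y) → T (adj G x y)
inP⇒adj G P {x} {y} P⊆G xy∈P =
  let e∈G , joins-e = lookupAny P⊆G (any⁻ (joins x y) (edges P) xy∈P)
  in SameEdge⇒adj G (joins⇒SameEdge _ joins-e) e∈G

△-spanning : ∀ {n} (G : SimpleGraph n) {F : EdgeSet n} (P : Walk n) →
             Spanning G F → EdgesIn G P → Spanning G (F △ P)
△-spanning G {F} P (F-sym , F⊆G) P⊆G =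
  (λ a b → cong₂ _xor_ (F-sym a b) (inP-sym P a b)) , △⊆G
  where
  △⊆G : (F △ P) ⊆ₑ adj G
  △⊆G a b ab∈ with F a b in Fab
  ... | true  = F⊆G a b (subst T (sym Fab) _)
  ... | false = inP⇒adj G P P⊆G ab∈

edge : ∀ {n} → Fin n → Fin n → Walk n
edge x y = x , y ∷ []

△-edge-reverse : ∀ {n} (F : EdgeSet n) (x y a b : Fin n) → (F △ edge x y) a b ≡ (F △ edge y x) a b
△-edge-reverse F x y a b = cong (λ t → F a b xor (t ∨ false)) $
  trans (∨-comm (⌊ x ≟ a ⌋ ∧ ⌊ y ≟ b ⌋) _)
        (cong₂ _∨_ (∧-comm ⌊ x ≟ b ⌋ ⌊ y ≟ a ⌋) (∧-comm ⌊ x ≟ a ⌋ ⌊ y ≟ b ⌋))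

module _ {n} (F : EdgeSet n) {x y : Fin n} (Fxy : F x y ≡ true) (x≢y : x ≢ y) where

  △-edge-row-start : ∀ w → indicator y w + bit ((F △ edge x y) x w) ≡ bit (F x w)
  △-edge-row-start w with x ≟ x | y ≟ w | x ≟ w | y ≟ x
  ... | no x≢x | _        | _     | _       = contradiction refl x≢x
  ... | _      | _        | _     | yes y≡x = contradiction (sym y≡x) x≢y
  ... | yes _  | yes refl | _     | no _    rewrite Fxy = refl
  ... | yes _  | no _     | yes _ | no _    = cong bit (xor-identityʳ (F x w))
  ... | yes _  | no _     | no _  | no _    = cong bit (xor-identityʳ (F x w))

  △-edge-row-other : ∀ {z} → x ≢ z → y ≢ z → ∀ w → (F △ edge x y) z w ≡ F z w
  △-edge-row-other {z} x≢z y≢z w with x ≟ z | y ≟ z | x ≟ w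
  ... | yes x≡z | _       | _     = contradiction x≡z x≢z
  ... | _       | yes y≡z | _     = contradiction y≡z y≢z
  ... | no _    | no _    | yes _ = xor-identityʳ (F z w)
  ... | no _    | no _    | no _  = xor-identityʳ (F z w)

  1+deg-△-edge-start : suc (deg (F △ edge x y) x) ≡ deg F x
  1+deg-△-edge-start = begin
    suc (deg (F △ edge x y) x)
      ≡⟨ cong suc (deg≡∑ (F △ edge x y) x) ⟩
    suc (∑[ w < n ] bit ((F △ edge x y) x w))
      ≡⟨ ∑-indicator-+ y _ ⟨
    ∑[ w < n ] (indicator y w + bit ((F △ edge x y) x w))
      ≡⟨ sum-cong-≗ △-edge-row-start ⟩
    ∑[ w < n ] bit (F x w)
      ≡⟨ deg≡∑ F x ⟨
    deg F x ∎
    where open ≡-Reasoning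

  deg-△-edge-other : ∀ {z} → x ≢ z → y ≢ z → deg (F △ edge x y) z ≡ deg F z
  deg-△-edge-other {z} x≢z y≢z = deg-cong (F △ edge x y) F z (△-edge-row-other x≢z y≢z)

module _ {n} (F : EdgeSet n) {x y : Fin n} (Fxy : F x y ≡ true) (Fyx : F y x ≡ true) (x≢y : x ≢ y) where

  private
    F′ : EdgeSet n
    F′ = F △ edge x y

    y≢x : y ≢ x
    y≢x = x≢y ∘ sym

  1+deg-△-edge-end : suc (deg F′ y) ≡ deg F y
  1+deg-△-edge-end = begin
    suc (deg F′ y)              ≡⟨ cong suc (deg-cong F′ (F △ edge y x) y (△-edge-reverse F x y y)) ⟩
    suc (deg (F △ edge y x) y)  ≡⟨ 1+deg-△-edge-start F Fyx y≢x ⟩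
    deg F y                     ∎
    where open ≡-Reasoning

  totalDegree-△-edge-< : totalDegree F′ < totalDegree F
  totalDegree-△-edge-< = begin
    suc (totalDegree F′)                   ≡⟨ ∑-indicator-+ x (deg F′) ⟨
    ∑[ z < n ] (indicator x z + deg F′ z)  ≤⟨ ∑-mono-≤ pointwise ⟩
    totalDegree F                          ∎
    where
    open ≤-Reasoning
    cases : ∀ {z} → Dec (x ≡ z) → Dec (y ≡ z) → indicator x z + deg F′ z ≤ deg F z
    cases (yes refl) _        rewrite indicator-self x = ≤-reflexive (1+deg-△-edge-start F Fxy x≢y)
    cases (no x≢z)   (yes refl) rewrite indicator-≢ x≢z = ≤-trans (n≤1+n _) (≤-reflexive 1+deg-△-edge-end)
    cases (no x≢z)   (no y≢z)   rewrite indicator-≢ x≢z = ≤-reflexive (deg-△-edge-other F Fxy x≢y x≢z y≢z)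

    pointwise : ∀ z → indicator x z + deg F′ z ≤ deg F z
    pointwise z = cases (x ≟ z) (y ≟ z)

  module _ (H : Assign n) (overfull : MH H x < deg F x) where

    defv-△-edge-start : defv H F′ x < defv H F x
    defv-△-edge-start =
      subst (λ d → dist (deg F′ x) (H x) < dist d (H x)) (1+deg-△-edge-start F Fxy x≢y)
            (dist-<-dist-suc (deg F′ x) (H x) below)
      where
      below : ∀ h → h ∈ toList (H x) → h ≤ deg F′ x
      below h h∈ = s≤s⁻¹ $ ≤-<-trans (≤-foldr₁-⊔ (H x) h∈)
                                     (subst (MH H x <_) (sym (1+deg-△-edge-start F Fxy x≢y)) overfull)

    defv-△-edge-end : defv H F′ y ≤ suc (defv H F y)
    defv-△-edge-end = subst (λ d → dist (deg F′ y) (H y) ≤ suc (dist d (H y))) 1+deg-△-edge-end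
                            (dist-≤-1+dist-suc (deg F′ y) (H y))

    defTotal-△-edge-≤ : defTotal H F′ ≤ defTotal H F
    defTotal-△-edge-≤ = subst₂ _≤_ (sym (defTotal≡∑ H F′)) (sym (defTotal≡∑ H F)) $ s≤s⁻¹ $ begin
      suc (∑[ z < n ] defv H F′ z)              ≡⟨ ∑-indicator-+ x (defv H F′) ⟨
      ∑[ z < n ] (indicator x z + defv H F′ z)  ≤⟨ ∑-mono-≤ pointwise ⟩
      ∑[ z < n ] (indicator y z + defv H F z)   ≡⟨ ∑-indicator-+ y (defv H F) ⟩
      suc (∑[ z < n ] defv H F z)               ∎
      where
      open ≤-Reasoning
      cases : ∀ {z} → Dec (x ≡ z) → Dec (y ≡ z) →
              indicator x z + defv H F′ z ≤ indicator y z + defv H F z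
      cases (yes refl) _          rewrite indicator-self x | indicator-≢ y≢x = defv-△-edge-start
      cases (no x≢z)   (yes refl) rewrite indicator-≢ x≢z | indicator-self y = defv-△-edge-end
      cases {z} (no x≢z) (no y≢z) rewrite indicator-≢ x≢z | indicator-≢ y≢z =
        ≤-reflexive (cong (λ d → dist d (H z)) (deg-△-edge-other F Fxy x≢y x≢z y≢z))

      pointwise : ∀ z → indicator x z + defv H F′ z ≤ indicator y z + defv H F z
      pointwise z = cases (x ≟ z) (y ≟ z)

spanning-neighbour : ∀ {n} (G : SimpleGraph n) {F : EdgeSet n} {x} → Spanning G F → 0 < deg F x →
                     ∃ λ y → F x y ≡ true × F y x ≡ true × x ≢ y
spanning-neighbour G {F} {x} (F-sym , F⊆G) pos with ∑-bit-pos⇒true (F x) (subst (0 <_) (deg≡∑ F x) pos)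
... | y , Fxy = y , Fxy , trans (sym (F-sym x y)) Fxy ,
                λ { refl → subst T (irrefl G x) (F⊆G x x (subst T (sym Fxy) _)) }

trim : ∀ {n} (G : SimpleGraph n) (H : Assign n) (F : EdgeSet n) → Spanning G F →
       Σ (EdgeSet n) λ F′ → Spanning G F′ × Bounded H F′ × defTotal H F′ ≤ defTotal H F
trim {n} G H F spanning = go (suc (totalDegree F)) F spanning ≤-refl
  where
  go : ∀ fuel (F : EdgeSet n) → Spanning G F → totalDegree F < fuel →
       Σ (EdgeSet n) λ F′ → Spanning G F′ × Bounded H F′ × defTotal H F′ ≤ defTotal H F
  go (suc fuel) F spanning td<fuel with all? (λ x → deg F x ≤? MH H x)
  ... | yes bounded = F , spanning , bounded , ≤-refl
  ... | no unbounded with ¬∀⟶∃¬ n _ (λ x → deg F x ≤? MH H x) unbounded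
  ...   | x , ¬bounded with spanning-neighbour G spanning (≤-<-trans z≤n (≰⇒> ¬bounded))
  ...     | y , Fxy , Fyx , x≢y =
    let F′ , spanning′ , bounded′ , def≤ =
          go fuel (F △ edge x y)
             (△-spanning G (edge x y) spanning (proj₂ spanning x y (subst T (sym Fxy) _) ∷ []))
             (≤-trans (totalDegree-△-edge-< F Fxy Fyx x≢y) (s≤s⁻¹ td<fuel))
    in F′ , spanning′ , bounded′ , ≤-trans def≤ (defTotal-△-edge-≤ F Fxy Fyx x≢y H (≰⇒> ¬bounded))

lemma1 : ∀ {n} (G : SimpleGraph n) (H : Assign n) → Star H →
         ¬ (Σ (EdgeSet n) λ F′ → IsHFactor G H F′) →
         (F : EdgeSet n) → Spanning G F → Bounded H F →
         (∀ F′ → Spanning G F′ → Bounded H F′ → defTotal H F ≤ defTotal H F′) →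
         (∀ F′ → Spanning G F′ → Bounded H F′ → F′ ⊆ₑ F →
            defTotal H F′ ≡ defTotal H F → F ⊆ₑ F′) →
         ¬ (Σ (Walk n) λ P → Changeable G H F P × defTotal H (F △ P) < defTotal H F)
lemma1 G H _ _ F spanning _ optimal _ (P , ((P⊆G , _) , _) , augmenting) =
  let F′ , spanning′ , bounded′ , def≤ = trim G H (F △ P) (△-spanning G P spanning P⊆G)
  in <⇒≱ augmenting (≤-trans (optimal F′ spanning′ bounded′) def≤)
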